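{- Let $G$ be a graph such that for every linear forest $H$ on $4$ vertices, $G$ contains no induced copy of $H$. Then the complement $\overline{G}$ is a disjoint union of stars and triangles.
   Context: A linear forest is a forest all of whose components are paths or isolated vertices. A single vertex counts as a star. -}

module Defs where

open import Data.Nat using (ℕ; suc; _+_)
open import Data.Fin using (Fin; toℕ; _≟_)
open import Data.Bool using (Bool; true; false; not; if_then_else_)
open import Data.Product using (Σ; ∃; _×_; _,_)
open import Data.Sum using (_⊎_)
open import Relation.Nullary using (¬_; does)
open import Relation.Binary.PropositionalEquality using (_≡_)
open import Function.Definitions using (Injective)

record Graph (n : ℕ) : Set where
  field
    adj    : Fin n → Fin n → Bool
    sym    : ∀ u v → adj u v ≡ adj v u
    irrefl : ∀ v → adj v v ≡ false
open Graph public

complement : ∀ {n} → Graph n → Graph n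
complement {n} G = record { adj = a ; sym = s ; irrefl = i }
  where
  a : Fin n → Fin n → Bool
  a u v = if does (u ≟ v) then false else not (adj G u v)
  s : ∀ u v → a u v ≡ a v u
  s u v with u ≟ v | v ≟ u
  ... | Relation.Nullary.yes _ | Relation.Nullary.yes _ = Relation.Binary.PropositionalEquality.refl
  ... | Relation.Nullary.yes p | Relation.Nullary.no q = Data.Empty.⊥-elim (q (Relation.Binary.PropositionalEquality.sym p))
    where import Data.Empty
  ... | Relation.Nullary.no p | Relation.Nullary.yes q = Data.Empty.⊥-elim (p (Relation.Binary.PropositionalEquality.sym q))
    where import Data.Empty
  ... | Relation.Nullary.no _ | Relation.Nullary.no _ = Relation.Binary.PropositionalEquality.cong not (sym G u v)
  i : ∀ v → a v v ≡ false
  i v with v ≟ v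
  ... | Relation.Nullary.yes _ = Relation.Binary.PropositionalEquality.refl
  ... | Relation.Nullary.no p = Data.Empty.⊥-elim (p Relation.Binary.PropositionalEquality.refl)
    where import Data.Empty

InducedCopy : ∀ {m n} → Graph m → Graph n → Set
InducedCopy {m} {n} H G =
  Σ (Fin m → Fin n) λ f → Injective _≡_ _≡_ f × (∀ i j → adj H i j ≡ adj G (f i) (f j))

-- Linear forest: a forest all of whose components are paths (or isolated
-- vertices), i.e. a disjoint union of paths; equivalently its vertices can be
-- laid out on a line (injective positions σ) so that every edge joins
-- consecutive positions.
LinearForest : ∀ {m} → Graph m → Set
LinearForest {m} H =
  Σ (Fin m → Fin m) λ σ → Injective _≡_ _≡_ σ ×
    (∀ u v → adj H u v ≡ true →
       (suc (toℕ (σ u)) ≡ toℕ (σ v)) ⊎ (suc (toℕ (σ v)) ≡ toℕ (σ u)))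

-- A part (set of vertices with label p) induces a star in K: there is a
-- centre z in the part, and two distinct vertices of the part are adjacent
-- iff one of them is z. (A single vertex, and K2, are stars.)
IsStarPart : ∀ {n} → Graph n → (Fin n → ℕ) → ℕ → Set
IsStarPart {n} K c p =
  Σ (Fin n) λ z → c z ≡ p ×
    (∀ u w → c u ≡ p → c w ≡ p → ¬ (u ≡ w) →
       (adj K u w ≡ true → (u ≡ z ⊎ w ≡ z)) × ((u ≡ z ⊎ w ≡ z) → adj K u w ≡ true))

IsTrianglePart : ∀ {n} → Graph n → (Fin n → ℕ) → ℕ → Set
IsTrianglePart {n} K c p =
  Σ (Fin n) λ a → Σ (Fin n) λ b → Σ (Fin n) λ d →
    c a ≡ p × c b ≡ p × c d ≡ p ×
    ¬ (a ≡ b) × ¬ (a ≡ d) × ¬ (b ≡ d) ×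
    adj K a b ≡ true × adj K a d ≡ true × adj K b d ≡ true ×
    (∀ u → c u ≡ p → (u ≡ a ⊎ u ≡ b ⊎ u ≡ d))

DisjointUnionOfStarsAndTriangles : ∀ {n} → Graph n → Set
DisjointUnionOfStarsAndTriangles {n} K =
  Σ (Fin n → ℕ) λ c →
    (∀ u w → ¬ (c u ≡ c w) → adj K u w ≡ false) ×
    (∀ v → IsStarPart K c (c v) ⊎ IsTrianglePart K c (c v))

module Submission where

-- Write K for the complement of G.  If K contained a path
-- a-b-c-d on four distinct vertices (as a subgraph, not necessarily
-- induced), then ab, bc, cd would be non-edges of G, so every edge of G on
-- {a,b,c,d} joins consecutive vertices of the order c,a,d,b: G would induce
-- a linear forest on four vertices.  Hence K is P4-free, and the theorem
-- reduces to the fact that every component of a P4-free graph is a star or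
-- a triangle.

open import Defs
open import Data.Nat using (ℕ; zero; suc)
open import Data.Fin using (Fin; toℕ; _≟_)
open import Data.Fin.Patterns using (0F; 1F; 2F; 3F)
open import Data.Fin.Properties using (any?; toℕ-injective)
open import Data.Bool using (true; false)
open import Data.Bool.Properties using () renaming (_≟_ to _≟ᵇ_)
open import Data.Product using (Σ; _×_; _,_)
open import Data.Sum using (_⊎_; inj₁; inj₂)
open import Data.Empty using (⊥; ⊥-elim)
open import Function.Definitions using (Injective)
open import Relation.Nullary using (¬_; Dec; yes; no)
open import Relation.Nullary.Decidable using (_×-dec_; _⊎-dec_; ¬?)
open import Relation.Unary using (Pred; Decidable)
import Relation.Binary.Definitions as Binary
open import Relation.Binary.Structures using (IsEquivalence)
open import Relation.Binary.PropositionalEquality as ≡ using (_≡_; _≢_; refl; cong; ≢-sym)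

false≢true : false ≢ true
false≢true ()

-- Least index satisfying a decidable predicate on Fin n (n if there is none).
firstIndex : ∀ {n p} {P : Pred (Fin n) p} → Decidable P → ℕ
firstIndex {zero} P? = zero
firstIndex {suc n} P? with P? Fin.zero
... | yes _ = zero
... | no _ = suc (firstIndex (λ x → P? (Fin.suc x)))

firstIndex-cong : ∀ {n p q} {P : Pred (Fin n) p} {Q : Pred (Fin n) q}
  (P? : Decidable P) (Q? : Decidable Q) →
  (∀ {x} → P x → Q x) → (∀ {x} → Q x → P x) → firstIndex P? ≡ firstIndex Q?
firstIndex-cong {zero} P? Q? to from = refl
firstIndex-cong {suc n} P? Q? to from with P? Fin.zero | Q? Fin.zero
... | yes _ | yes _ = refl
... | yes p | no ¬q = ⊥-elim (¬q (to p))
... | no ¬p | yes q = ⊥-elim (¬p (from q))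
... | no _ | no _ =
  cong suc (firstIndex-cong (λ x → P? (Fin.suc x)) (λ x → Q? (Fin.suc x)) to from)

firstIndex-witness : ∀ {n p} {P : Pred (Fin n) p} (P? : Decidable P) {v : Fin n} → P v →
  Σ (Fin n) λ u → P u × toℕ u ≡ firstIndex P?
firstIndex-witness {suc n} P? {v} pv with P? Fin.zero
... | yes p₀ = Fin.zero , p₀ , refl
firstIndex-witness {suc n} P? {Fin.zero} pv | no ¬p₀ = ⊥-elim (¬p₀ pv)
firstIndex-witness {suc n} P? {Fin.suc v} pv | no _
  with firstIndex-witness (λ x → P? (Fin.suc x)) pv
... | u , pu , u-least = Fin.suc u , pu , cong suc u-least

module ClassLabel {n ℓ} {_~_ : Fin n → Fin n → Set ℓ}
  (isEquivalence : IsEquivalence _~_) (_~?_ : Binary.Decidable _~_) where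

  private module ~ = IsEquivalence isEquivalence

  label : Fin n → ℕ
  label v = firstIndex (v ~?_)

  label-respects : ∀ {u v} → u ~ v → label u ≡ label v
  label-respects u~v =
    firstIndex-cong (_ ~?_) (_ ~?_) (~.trans (~.sym u~v)) (~.trans u~v)

  label-reflects : ∀ {u v} → label u ≡ label v → u ~ v
  label-reflects {u} {v} same
    with firstIndex-witness (u ~?_) ~.refl | firstIndex-witness (v ~?_) ~.refl
  ... | x , u~x , x-least | y , v~y , y-least
    with toℕ-injective (≡.trans x-least (≡.trans same (≡.sym y-least)))
  ... | refl = ~.trans u~x (~.sym v~y)

induced : ∀ {m n} → Graph n → (Fin m → Fin n) → Graph m
induced G f = record
  { adj = λ i j → adj G (f i) (f j)
  ; sym = λ i j → sym G (f i) (f j)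
  ; irrefl = λ i → irrefl G (f i) }

induced-copy : ∀ {m n} (G : Graph n) (f : Fin m → Fin n) →
  Injective _≡_ _≡_ f → InducedCopy (induced G f) G
induced-copy G f f-injective = f , f-injective , λ _ _ → refl

consecutive⇒linearForest : ∀ {m} (H : Graph m) →
  (∀ u v → adj H u v ≡ true → suc (toℕ u) ≡ toℕ v ⊎ suc (toℕ v) ≡ toℕ u) →
  LinearForest H
consecutive⇒linearForest H consecutive = (λ i → i) , (λ same → same) , consecutive

module FourVertexPath {n} (G : Graph n) (x₀ x₁ x₂ x₃ : Fin n)
  (x₀≢x₁ : x₀ ≢ x₁) (x₀≢x₂ : x₀ ≢ x₂) (x₀≢x₃ : x₀ ≢ x₃)
  (x₁≢x₂ : x₁ ≢ x₂) (x₁≢x₃ : x₁ ≢ x₃) (x₂≢x₃ : x₂ ≢ x₃)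
  (x₀x₂ : adj G x₀ x₂ ≡ false) (x₀x₃ : adj G x₀ x₃ ≡ false)
  (x₁x₃ : adj G x₁ x₃ ≡ false) where

  vertex : Fin 4 → Fin n
  vertex 0F = x₀
  vertex 1F = x₁
  vertex 2F = x₂
  vertex 3F = x₃

  vertex-injective : Injective _≡_ _≡_ vertex
  vertex-injective {0F} {0F} _ = refl
  vertex-injective {0F} {1F} e = ⊥-elim (x₀≢x₁ e)
  vertex-injective {0F} {2F} e = ⊥-elim (x₀≢x₂ e)
  vertex-injective {0F} {3F} e = ⊥-elim (x₀≢x₃ e)
  vertex-injective {1F} {0F} e = ⊥-elim (x₀≢x₁ (≡.sym e))
  vertex-injective {1F} {1F} _ = refl
  vertex-injective {1F} {2F} e = ⊥-elim (x₁≢x₂ e)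
  vertex-injective {1F} {3F} e = ⊥-elim (x₁≢x₃ e)
  vertex-injective {2F} {0F} e = ⊥-elim (x₀≢x₂ (≡.sym e))
  vertex-injective {2F} {1F} e = ⊥-elim (x₁≢x₂ (≡.sym e))
  vertex-injective {2F} {2F} _ = refl
  vertex-injective {2F} {3F} e = ⊥-elim (x₂≢x₃ e)
  vertex-injective {3F} {0F} e = ⊥-elim (x₀≢x₃ (≡.sym e))
  vertex-injective {3F} {1F} e = ⊥-elim (x₁≢x₃ (≡.sym e))
  vertex-injective {3F} {2F} e = ⊥-elim (x₂≢x₃ (≡.sym e))
  vertex-injective {3F} {3F} _ = refl

  H : Graph 4
  H = induced G vertex

  private
    non-edge : ∀ {x y} {A : Set} → adj G x y ≡ false → adj G x y ≡ true → A
    non-edge absent present = ⊥-elim (false≢true (≡.trans (≡.sym absent) present))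

    non-edge˘ : ∀ {x y} {A : Set} → adj G x y ≡ false → adj G y x ≡ true → A
    non-edge˘ {x} {y} absent present = non-edge absent (≡.trans (sym G x y) present)

  edges-consecutive : ∀ u v → adj H u v ≡ true → suc (toℕ u) ≡ toℕ v ⊎ suc (toℕ v) ≡ toℕ u
  edges-consecutive 0F 1F _ = inj₁ refl
  edges-consecutive 1F 2F _ = inj₁ refl
  edges-consecutive 2F 3F _ = inj₁ refl
  edges-consecutive 1F 0F _ = inj₂ refl
  edges-consecutive 2F 1F _ = inj₂ refl
  edges-consecutive 3F 2F _ = inj₂ refl
  edges-consecutive 0F 2F e = non-edge x₀x₂ e
  edges-consecutive 0F 3F e = non-edge x₀x₃ e
  edges-consecutive 1F 3F e = non-edge x₁x₃ e
  edges-consecutive 2F 0F e = non-edge˘ x₀x₂ e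
  edges-consecutive 3F 0F e = non-edge˘ x₀x₃ e
  edges-consecutive 3F 1F e = non-edge˘ x₁x₃ e
  edges-consecutive 0F 0F e = non-edge (irrefl G x₀) e
  edges-consecutive 1F 1F e = non-edge (irrefl G x₁) e
  edges-consecutive 2F 2F e = non-edge (irrefl G x₂) e
  edges-consecutive 3F 3F e = non-edge (irrefl G x₃) e

  H-linearForest : LinearForest H
  H-linearForest = consecutive⇒linearForest H edges-consecutive

  H-induced : InducedCopy H G
  H-induced = induced-copy G vertex vertex-injective

complement-edge : ∀ {n} (G : Graph n) {u v : Fin n} →
  adj (complement G) u v ≡ true → u ≢ v × adj G u v ≡ false
complement-edge G {u} {v} e with u ≟ v
... | yes _ = ⊥-elim (false≢true e)
... | no u≢v with adj G u v
...   | true = ⊥-elim (false≢true e)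
...   | false = u≢v , refl

-- K contains no path on four vertices as a (not necessarily induced)
-- subgraph; adjacent vertices are distinct, so a,b,c,d are pairwise distinct.
P4Free : ∀ {n} → Graph n → Set
P4Free {n} K = ∀ (a b c d : Fin n) → a ≢ c → b ≢ d → a ≢ d →
  adj K a b ≡ true → adj K b c ≡ true → adj K c d ≡ true → ⊥

-- A path a-b-c-d in the complement makes G induce, on the vertex order
-- c,a,d,b, a subgraph of a path, i.e. a linear forest on four vertices.
complement-P4Free : ∀ {n} (G : Graph n) →
  ((H : Graph 4) → LinearForest H → ¬ InducedCopy H G) → P4Free (complement G)
complement-P4Free G noLinearForest a b c d a≢c b≢d a≢d ab bc cd
  with complement-edge G ab | complement-edge G bc | complement-edge G cd
... | a≢b , Gab | b≢c , Gbc | c≢d , Gcd =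
  noLinearForest Path.H Path.H-linearForest Path.H-induced
  where
  module Path = FourVertexPath G c a d b
    (≢-sym a≢c) c≢d (≢-sym b≢c) a≢d a≢b (≢-sym b≢d)
    Gcd (≡.trans (sym G c b) Gbc) Gab

module P4FreeComponents {n} (K : Graph n) (p4Free : P4Free K) where

  E : Fin n → Fin n → Set
  E u v = adj K u v ≡ true

  E? : Binary.Decidable E
  E? u v = adj K u v ≟ᵇ true

  E-sym : ∀ {u v} → E u v → E v u
  E-sym {u} {v} e = ≡.trans (sym K v u) e

  E-distinct : ∀ {u v} → E u v → u ≢ v
  E-distinct {u} e refl = false≢true (≡.trans (≡.sym (irrefl K u)) e)

  -- u is within distance two of v.  In a P4-free graph this is exactly
  -- "u lies in the component of v".
  Near : Fin n → Fin n → Set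
  Near v u = u ≡ v ⊎ E v u ⊎ Σ (Fin n) λ m → E v m × E m u

  Near? : Binary.Decidable Near
  Near? v u = (u ≟ v) ⊎-dec E? v u ⊎-dec any? (λ m → E? v m ×-dec E? m u)

  near-refl : ∀ {v} → Near v v
  near-refl = inj₁ refl

  near-sym : ∀ {v u} → Near v u → Near u v
  near-sym (inj₁ refl) = inj₁ refl
  near-sym (inj₂ (inj₁ e)) = inj₂ (inj₁ (E-sym e))
  near-sym (inj₂ (inj₂ (m , vm , mu))) = inj₂ (inj₂ (m , E-sym mu , E-sym vm))

  -- The ends of a walk of length three are near: otherwise it is a P4.
  walk3-near : ∀ {a x y c} → E a x → E x y → E y c → Near a c
  walk3-near {a} {x} {y} {c} ax xy yc with c ≟ a | a ≟ y | x ≟ c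
  ... | yes c≡a | _ | _ = inj₁ c≡a
  ... | no _ | yes refl | _ = inj₂ (inj₁ yc)
  ... | no _ | no _ | yes refl = inj₂ (inj₁ ax)
  ... | no c≢a | no a≢y | no x≢c = ⊥-elim (p4Free a x y c a≢y x≢c (≢-sym c≢a) ax xy yc)

  near-step : ∀ {a b c} → Near a b → E b c → Near a c
  near-step (inj₁ refl) bc = inj₂ (inj₁ bc)
  near-step {b = b} (inj₂ (inj₁ ab)) bc = inj₂ (inj₂ (b , ab , bc))
  near-step (inj₂ (inj₂ (m , am , mb))) bc = walk3-near am mb bc

  near-trans : ∀ {a b c} → Near a b → Near b c → Near a c
  near-trans ab (inj₁ refl) = ab
  near-trans ab (inj₂ (inj₁ bc)) = near-step ab bc
  near-trans ab (inj₂ (inj₂ (m , bm , mc))) = near-step (near-step ab bm) mc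

  near-isEquivalence : IsEquivalence Near
  near-isEquivalence = record { refl = near-refl ; sym = near-sym ; trans = near-trans }

  open ClassLabel near-isEquivalence Near? using (label; label-respects; label-reflects)

  same-part : ∀ {v u} → label u ≡ label v → Near v u
  same-part same = label-reflects (≡.sym same)

  no-cross-edges : ∀ u w → label u ≢ label w → adj K u w ≡ false
  no-cross-edges u w different with adj K u w in uw
  ... | true = ⊥-elim (different (label-respects (inj₂ (inj₁ uw))))
  ... | false = refl

  -- A triangle is a whole component: a further vertex near it gives a P4.
  triangle-closed : ∀ {a b d u} → E a b → E a d → E b d → Near a u →
    u ≡ a ⊎ u ≡ b ⊎ u ≡ d
  triangle-closed ab ad bd (inj₁ u≡a) = inj₁ u≡a
  triangle-closed {a} {b} {d} {u} ab ad bd (inj₂ (inj₁ au)) with u ≟ b | u ≟ d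
  ... | yes u≡b | _ = inj₂ (inj₁ u≡b)
  ... | no _ | yes u≡d = inj₂ (inj₂ u≡d)
  ... | no u≢b | no u≢d = ⊥-elim (p4Free u a b d u≢b (E-distinct ad) u≢d (E-sym au) ab bd)
  triangle-closed {a} {b} {d} {u} ab ad bd (inj₂ (inj₂ (m , am , mu)))
    with u ≟ a | u ≟ b | u ≟ d
  ... | yes u≡a | _ | _ = inj₁ u≡a
  ... | no _ | yes u≡b | _ = inj₂ (inj₁ u≡b)
  ... | no _ | no _ | yes u≡d = inj₂ (inj₂ u≡d)
  ... | no u≢a | no u≢b | no u≢d with m ≟ b | m ≟ d
  ...   | yes refl | _ =
    ⊥-elim (p4Free u m a d u≢a (E-distinct bd) u≢d (E-sym mu) (E-sym am) ad)
  ...   | no _ | yes refl =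
    ⊥-elim (p4Free u m a b u≢a (≢-sym (E-distinct bd)) u≢b (E-sym mu) (E-sym am) ab)
  ...   | no m≢b | no m≢d =
    ⊥-elim (p4Free m a b d m≢b (E-distinct ad) m≢d (E-sym am) ab bd)

  Triangle : Fin n → Set
  Triangle v = Σ (Fin n) λ a → Σ (Fin n) λ b → Σ (Fin n) λ d →
    Near v a × E a b × E a d × E b d

  Triangle? : ∀ v → Dec (Triangle v)
  Triangle? v = any? λ a → any? λ b → any? λ d →
    Near? v a ×-dec E? a b ×-dec E? a d ×-dec E? b d

  triangle-part : ∀ {v} → Triangle v → IsTrianglePart K label (label v)
  triangle-part {v} (a , b , d , va , ab , ad , bd) =
    a , b , d ,
    ≡.sym (label-respects va) ,
    ≡.sym (label-respects (near-step va ab)) ,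
    ≡.sym (label-respects (near-step va ad)) ,
    E-distinct ab , E-distinct ad , E-distinct bd , ab , ad , bd ,
    λ u same → triangle-closed ab ad bd (near-trans (near-sym va) (same-part same))

  Dominates : Fin n → Fin n → Set
  Dominates v z = ∀ {x} → Near v x → x ≢ z → E z x

  -- A triangle-free component with a dominating vertex z is a star centred
  -- at z: an edge avoiding z would close a triangle with z.
  star-part : ∀ {v z} → Near v z → Dominates v z → ¬ Triangle v →
    IsStarPart K label (label v)
  star-part {v} {z} vz dominates noTriangle =
    z , ≡.sym (label-respects vz) , λ u w su sw u≢w → to su sw , from su sw u≢w
    where
    to : ∀ {u w} → label u ≡ label v → label w ≡ label v →
      E u w → u ≡ z ⊎ w ≡ z
    to {u} {w} su sw uw with u ≟ z | w ≟ z
    ... | yes u≡z | _ = inj₁ u≡z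
    ... | no _ | yes w≡z = inj₂ w≡z
    ... | no u≢z | no w≢z = ⊥-elim (noTriangle
      (z , u , w , vz , dominates (same-part su) u≢z , dominates (same-part sw) w≢z , uw))
    from : ∀ {u w} → label u ≡ label v → label w ≡ label v → u ≢ w →
      u ≡ z ⊎ w ≡ z → E u w
    from su sw u≢w (inj₁ refl) = dominates (same-part sw) (≢-sym u≢w)
    from su sw u≢w (inj₂ refl) = E-sym (dominates (same-part su) u≢w)

  Branching : Fin n → Set
  Branching v = Σ (Fin n) λ z → Σ (Fin n) λ y₁ → Σ (Fin n) λ y₂ →
    Near v z × E z y₁ × E z y₂ × y₁ ≢ y₂

  Branching? : ∀ v → Dec (Branching v)
  Branching? v = any? λ z → any? λ y₁ → any? λ y₂ →
    Near? v z ×-dec E? z y₁ ×-dec E? z y₂ ×-dec ¬? (y₁ ≟ y₂)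

  -- If z-m-x is a walk with x ≢ z, then x is adjacent to z as soon as z has
  -- a neighbour y other than m: either x is y, or x-m-z-y is a P4.
  second-neighbour-closes : ∀ {z m x y} → E z m → E m x → x ≢ z → E z y → m ≢ y → E z x
  second-neighbour-closes {z} {m} {x} {y} zm mx x≢z zy m≢y with x ≟ y
  ... | yes refl = zy
  ... | no x≢y = ⊥-elim (p4Free x m z y x≢z m≢y x≢y (E-sym mx) (E-sym zm) zy)

  branch-dominates : ∀ {v z y₁ y₂} → Near v z → E z y₁ → E z y₂ → y₁ ≢ y₂ →
    Dominates v z
  branch-dominates {v} {z} {y₁} vz zy₁ zy₂ y₁≢y₂ {x} vx x≢z
    with near-trans (near-sym vz) vx
  ... | inj₁ x≡z = ⊥-elim (x≢z x≡z)
  ... | inj₂ (inj₁ zx) = zx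
  ... | inj₂ (inj₂ (m , zm , mx)) with m ≟ y₁
  ...   | yes refl = second-neighbour-closes zm mx x≢z zy₂ y₁≢y₂
  ...   | no m≢y₁ = second-neighbour-closes zm mx x≢z zy₁ m≢y₁

  -- Without branching vertices, v dominates its component: a vertex at
  -- distance two from v via m would be a second neighbour of m.
  unbranched-dominates : ∀ {v} → ¬ Branching v → Dominates v v
  unbranched-dominates noBranching (inj₁ x≡v) x≢v = ⊥-elim (x≢v x≡v)
  unbranched-dominates noBranching (inj₂ (inj₁ vx)) x≢v = vx
  unbranched-dominates {v} noBranching {x} (inj₂ (inj₂ (m , vm , mx))) x≢v with v ≟ x
  ... | yes v≡x = ⊥-elim (x≢v (≡.sym v≡x))
  ... | no v≢x = ⊥-elim (noBranching (m , v , x , inj₂ (inj₁ vm) , E-sym vm , mx , v≢x))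

  part : ∀ v → IsStarPart K label (label v) ⊎ IsTrianglePart K label (label v)
  part v with Triangle? v
  ... | yes triangle = inj₂ (triangle-part triangle)
  ... | no noTriangle with Branching? v
  ...   | yes (z , y₁ , y₂ , vz , zy₁ , zy₂ , y₁≢y₂) =
    inj₁ (star-part vz (branch-dominates vz zy₁ zy₂ y₁≢y₂) noTriangle)
  ...   | no noBranching = inj₁ (star-part near-refl (unbranched-dominates noBranching) noTriangle)

  starsAndTriangles : DisjointUnionOfStarsAndTriangles K
  starsAndTriangles = label , no-cross-edges , part

proposition8p1 : (n : ℕ) (G : Graph n) →
    ((H : Graph 4) → LinearForest H → ¬ InducedCopy H G) →
    DisjointUnionOfStarsAndTriangles (complement G)
proposition8p1 n G noLinearForest =
  P4FreeComponents.starsAndTriangles (complement G) (complement-P4Free G noLinearForest)
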